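{- Let $\mathcal{G}$ be a temporal graph with lifetime $T$, let $c$ be a positive integer, and let $(H,\mathcal{D})$ be a nice tree decomposition of its underlying graph. Let $b$ be a join node with children $b_1$ and $b_2$ such that $\mathcal{D}(b)=\mathcal{D}(b_1)=\mathcal{D}(b_2)$. Then a state $(\pi,\alpha,\beta,\gamma)$ is valid for $b$ if and only if there exist valid states $(\pi_1,\alpha_1,\beta_1,\gamma_1)$ of $b_1$ and $(\pi_2,\alpha_2,\beta_2,\gamma_2)$ of $b_2$ such that: (1) $\pi(v,t)=\pi_1(v,t)=\pi_2(v,t)$ for all $v\in \mathcal{D}(b)$ and $t\in [T]$; (2) $\alpha(p)=\alpha_{1}(p)+\alpha_2(p)$ for all $p \in[c]$; (3) $\beta(p,t)=\beta_1(p,t)+\beta_2(p,t)$ for all $p \in [c]$, $t\in [T]$; and (4) $\gamma=\gamma_1+\gamma_2$.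
   Context: A temporal graph $\mathcal{G}=(G,\lambda)$ with lifetime $T$: $G=(V,E)$ simple undirected (the underlying graph), $\lambda:E\to2^{[T]}$, snapshots $G_t=(V,E_t)$ with $E_t=\{e:t\in\lambda(e)\}$, $d_{u,t}$ the degree of $u$ in $G_t$; $m=|E|$, $n=|V|$. A tree decomposition $(H,\mathcal{D})$ of $G$ is a tree $H$ with bags $\mathcal{D}(b)\subseteq V$ ($b\in V(H)$) such that every vertex is in some bag, every edge has both ends in some bag, and for each vertex the nodes whose bags contain it induce a connected subtree. It is nice if $H$ is rooted, all leaves and the root have empty bags, and every non-leaf node is an introduce node (one child $b'$, $\mathcal{D}(b)=\mathcal{D}(b')\cup\{v\}$ with $v\notin\mathcal{D}(b')$), a forget node (one child $b'$, $\mathcal{D}(b)=\mathcal{D}(b')\setminus\{v\}$ with $v\in\mathcal{D}(b')$), or a join node (two children $b_1,b_2$ with $\mathcal{D}(b)=\mathcal{D}(b_1)=\mathcal{D}(b_2)$). $V_b$ is the union of $\mathcal{D}(b)$ and all bags of nodes below $b$; $V_b\setminus\mathcal{D}(b)$ is the set of vertices forgotten at $b$. A state of $b$ is a tuple $(\pi,\alpha,\beta,\gamma)$ with $\pi:\mathcal{D}(b)\times[T]\to[c]$, $\alpha:[c]\to\{0,\dots,mT\}$, $\beta:[c]\times[T]\to\{0,\dots,2m\}$, and an integer $\gamma$. It is valid if there is a function $\pi^*:V_b\times[T]\to[c]$ (said to support it) with $\pi^*|_{\mathcal{D}(b)\times[T]}=\pi$; $\alpha(p)=|\{(uv,t): t\in[T],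 uv\in E_t, \pi^*(u,t)=\pi^*(v,t)=p, \{u,v\}\cap(V_b\setminus\mathcal{D}(b))\ne\emptyset\}|$ for each $p\in[c]$; $\beta(p,t)=\sum_{u\in V_b\setminus\mathcal{D}(b),\,\pi^*(u,t)=p}d_{u,t}$ for all $p,t$; and $\gamma=\sum_{v\in V_b\setminus\mathcal{D}(b)}\sum_{t=1}^{T-1}\mathbf{1}[\pi^*(v,t)=\pi^*(v,t+1)]$. -}

module Defs where

open import Data.Nat using (ℕ; zero; suc; _+_; _*_; _≤_; _<ᵇ_)
open import Data.Integer using (ℤ; +_)
open import Data.Bool using (Bool; true; false; _∧_; _∨_; not; if_then_else_)
open import Data.Fin using (Fin; toℕ; inject₁) renaming (zero to fzero; suc to fsuc)
import Data.Fin as F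
open import Data.Fin.Subset using (Subset; _∈_; _∉_; _∪_; _-_; ⁅_⁆; ⊥)
open import Data.Fin.Subset.Properties using (_∈?_)
open import Data.Product using (Σ; ∃; _×_; _,_)
open import Data.Sum using (_⊎_)
open import Relation.Nullary using (does)
open import Relation.Binary.PropositionalEquality using (_≡_)
open import Relation.Binary.Construct.Closure.ReflexiveTransitive using (Star)

∑ : (n : ℕ) → (Fin n → ℕ) → ℕ
∑ zero    f = 0
∑ (suc n) f = f fzero + ∑ n (λ i → f (fsuc i))

[_] : Bool → ℕ
[ b ] = if b then 1 else 0

_==_ : ∀ {k} → Fin k → Fin k → Bool
i == j = does (i F.≟ j)

_∈ᵇ_ : ∀ {n} → Fin n → Subset n → Bool
v ∈ᵇ D = does (v ∈? D)

-- Temporal graphs on vertex set Fin n with lifetime T.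
-- Times [T] = {1..T} are represented by Fin T (time i+1 is  i : Fin T).

record TemporalGraph (n T : ℕ) : Set where
  field
    adj       : Fin n → Fin n → Bool
    adj-sym   : ∀ u v → adj u v ≡ adj v u
    adj-irr   : ∀ u → adj u u ≡ false
    -- labelling λ : E → 2^[T];  lab u v t = true  iff  t ∈ λ(uv)
    lab       : Fin n → Fin n → Fin T → Bool
    lab-sym   : ∀ u v t → lab u v t ≡ lab v u t
    lab-edge  : ∀ u v t → lab u v t ≡ true → adj u v ≡ true

module _ {n T : ℕ} (G : TemporalGraph n T) where
  open TemporalGraph G

  edgeAt : Fin n → Fin n → Fin T → Bool
  edgeAt u v t = lab u v t

  numEdges : ℕ
  numEdges = ∑ n (λ u → ∑ n (λ v → [ (toℕ u <ᵇ toℕ v) ∧ adj u v ]))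

  deg : Fin n → Fin T → ℕ
  deg u t = ∑ n (λ v → [ edgeAt u v t ])

data Tree (n : ℕ) : Set where
  leaf   : Subset n → Tree n
  unary  : Subset n → Tree n → Tree n
  binary : Subset n → Tree n → Tree n → Tree n

bag : ∀ {n} → Tree n → Subset n
bag (leaf D)         = D
bag (unary D _)      = D
bag (binary D _ _)   = D

Vb : ∀ {n} → Tree n → Subset n
Vb (leaf D)         = D
Vb (unary D t)      = D ∪ Vb t
Vb (binary D t₁ t₂) = D ∪ (Vb t₁ ∪ Vb t₂)

data Pos {n : ℕ} : Tree n → Set where
  here : ∀ {t} → Pos t
  inU  : ∀ {D t} → Pos t → Pos (unary D t)
  inL  : ∀ {D t₁ t₂} → Pos t₁ → Pos (binary D t₁ t₂)
  inR  : ∀ {D t₁ t₂} → Pos t₂ → Pos (binary D t₁ t₂)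

sub : ∀ {n} (t : Tree n) → Pos t → Tree n
sub t                here    = t
sub (unary _ t)      (inU p) = sub t p
sub (binary _ t _)   (inL p) = sub t p
sub (binary _ _ t)   (inR p) = sub t p

data ChildOf {n : ℕ} : {t : Tree n} → Pos t → Pos t → Set where
  cU : ∀ {D t} → ChildOf {t = unary D t} here (inU here)
  cL : ∀ {D t₁ t₂} → ChildOf {t = binary D t₁ t₂} here (inL here)
  cR : ∀ {D t₁ t₂} → ChildOf {t = binary D t₁ t₂} here (inR here)
  dU : ∀ {D t} {p q : Pos t} → ChildOf p q → ChildOf {t = unary D t} (inU p) (inU q)
  dL : ∀ {D t₁ t₂} {p q : Pos t₁} → ChildOf p q → ChildOf {t = binary D t₁ t₂} (inL p) (inL q)
  dR : ∀ {D t₁ t₂} {p q : Pos t₂} → ChildOf p q → ChildOf {t = binary D t₁ t₂} (inR p) (inR q)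

TreeAdj : ∀ {n} {t : Tree n} → Pos t → Pos t → Set
TreeAdj p q = ChildOf p q ⊎ ChildOf q p

record IsTreeDecomposition {n T : ℕ} (G : TemporalGraph n T) (H : Tree n) : Set where
  open TemporalGraph G
  field
    vertex-cover : ∀ v → ∃ λ (p : Pos H) → v ∈ bag (sub H p)
    edge-cover   : ∀ u v → adj u v ≡ true →
                   ∃ λ (p : Pos H) → (u ∈ bag (sub H p)) × (v ∈ bag (sub H p))
    -- the nodes whose bags contain v induce a connected subtree of H
    connected    : ∀ v (p q : Pos H) → v ∈ bag (sub H p) → v ∈ bag (sub H q) →
                   Star (λ x y → TreeAdj x y × (v ∈ bag (sub H x)) × (v ∈ bag (sub H y))) p q

data NiceNodes {n : ℕ} : Tree n → Set where
  leaf-nice   : ∀ {D} → (∀ v → v ∉ D) → NiceNodes (leaf D)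
  intro-nice  : ∀ {D t} v → v ∉ bag t → D ≡ bag t ∪ ⁅ v ⁆ → NiceNodes t → NiceNodes (unary D t)
  forget-nice : ∀ {D t} v → v ∈ bag t → D ≡ bag t - v → NiceNodes t → NiceNodes (unary D t)
  join-nice   : ∀ {D t₁ t₂} → D ≡ bag t₁ → D ≡ bag t₂ → NiceNodes t₁ → NiceNodes t₂ →
                NiceNodes (binary D t₁ t₂)

record IsNiceTreeDecomposition {n T : ℕ} (G : TemporalGraph n T) (H : Tree n) : Set where
  field
    isTD      : IsTreeDecomposition G H
    root-empty : ∀ v → v ∉ bag H
    nice      : NiceNodes H

-- States (π, α, β, γ) of a node.
-- π is given as a function on all of V × [T]; only its values on D(b) × [T]
-- are relevant.

record State (n T c : ℕ) : Set where
  constructor state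
  field
    π : Fin n → Fin T → Fin c
    α : Fin c → ℕ
    β : Fin c → Fin T → ℕ
    γ : ℤ

module _ {n T : ℕ} (G : TemporalGraph n T) {c : ℕ} where
  open State

  InRange : State n T c → Set
  InRange s = (∀ p → α s p ≤ numEdges G * T) × (∀ p t → β s p t ≤ 2 * numEdges G)

  module _ (b : Tree n) (πs : Fin n → Fin T → Fin c) where
    forgotten : Fin n → Bool
    forgotten u = (u ∈ᵇ Vb b) ∧ not (u ∈ᵇ bag b)

    alphaOf : Fin c → ℕ
    alphaOf p = ∑ T (λ t → ∑ n (λ u → ∑ n (λ v →
      [ (toℕ u <ᵇ toℕ v) ∧ edgeAt G u v t ∧ (πs u t == p) ∧ (πs v t == p)
        ∧ (forgotten u ∨ forgotten v) ])))

    betaOf : Fin c → Fin T → ℕ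
    betaOf p t = ∑ n (λ u → [ forgotten u ∧ (πs u t == p) ] * deg G u t)

    sameConsec : ∀ {k} → (Fin k → Fin c) → ℕ
    sameConsec {zero}  f = 0
    sameConsec {suc k} f = ∑ k (λ i → [ f (inject₁ i) == f (fsuc i) ])

    gammaOf : ℕ
    gammaOf = ∑ n (λ v → [ forgotten v ] * sameConsec (πs v))

  Supports : (b : Tree n) → (Fin n → Fin T → Fin c) → State n T c → Set
  Supports b πs s =
    (∀ v t → v ∈ bag b → πs v t ≡ π s v t) ×
    (∀ p → α s p ≡ alphaOf b πs p) ×
    (∀ p t → β s p t ≡ betaOf b πs p t) ×
    (γ s ≡ + gammaOf b πs)

  Valid : Tree n → State n T c → Set
  Valid b s = ∃ λ (πs : Fin n → Fin T → Fin c) → Supports b πs s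

-- At a join node the vertices forgotten at b are exactly those forgotten in one of the two
-- children, and never in both: a vertex outside D occurring below both children would have
-- to occur in D by connectivity. Likewise the neighbours of a vertex forgotten at a node lie
-- below that node, so an edge with a forgotten endpoint is counted on exactly one side.
-- Hence α, β and γ of any π* at b are the sums of those at b₁ and b₂. Conversely, supporting
-- functions π₁, π₂ of the children agree on D, so they glue (π₂ on V_{b₂}, π₁ elsewhere) to
-- a function whose counts at each child are unchanged, as these only read π* on V_{bᵢ}.

module Submission where

open import Defs
open import Algebra.Bundles using (CommutativeMonoid)
open import Data.Nat using (ℕ; zero; suc; _≤_; _+_; _*_; _<ᵇ_)
open import Data.Nat.Properties using (+-0-commutativeMonoid; *-distribʳ-+; ≤-trans; m≤m+n; m≤n+m)
open import Data.Integer using () renaming (_+_ to _+ℤ_)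
import Data.Integer as ℤ
open import Data.Bool using (Bool; true; false; T; _∧_; _∨_; not)
open import Data.Bool.Properties using (T-∧; T-∨; T-≡; ∧-zeroʳ; ∧-distribʳ-∨; ∨-commutativeMonoid)
open import Data.Fin using (Fin; zero; suc; inject₁; toℕ)
open import Data.Fin.Subset using (Subset; _∈_; _∉_; _⊆_; _∪_)
open import Data.Fin.Subset.Properties using (_∈?_; x∈p∪q⁺; x∈p∪q⁻)
open import Data.Vec using (_∷_; lookup)
open import Data.Vec.Properties using (lookup-zipWith)
open import Data.Product using (Σ; ∃; _×_; _,_; proj₁; proj₂; map; uncurry)
open import Data.Sum using (_⊎_; inj₁; inj₂)
import Data.Sum as Sum
open import Data.Empty using (⊥; ⊥-elim)
open import Function.Base using (_∘_; id)
open import Function.Bundles using (_⇔_; mk⇔; Equivalence)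
open import Relation.Nullary using (yes; no; contradiction)
open import Relation.Binary.PropositionalEquality
  using (_≡_; refl; sym; trans; cong; cong₂; subst; module ≡-Reasoning)
open import Relation.Binary.Construct.Closure.ReflexiveTransitive using (Star; ε; _◅_)
open import Algebra.Properties.CommutativeMonoid.Sum +-0-commutativeMonoid using (sum; ∑-distrib-+)
open import Algebra.Properties.CommutativeSemigroup
  (CommutativeMonoid.commutativeSemigroup ∨-commutativeMonoid) using () renaming (interchange to ∨-interchange)

open ≡-Reasoning
open Equivalence using (to)

∑≡sum : ∀ n (f : Fin n → ℕ) → ∑ n f ≡ sum f
∑≡sum zero    f = refl
∑≡sum (suc n) f = cong (f zero +_) (∑≡sum n (f ∘ suc))

∑-cong : ∀ n {f g : Fin n → ℕ} → (∀ i → f i ≡ g i) → ∑ n f ≡ ∑ n g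
∑-cong zero    f≗g = refl
∑-cong (suc n) f≗g = cong₂ _+_ (f≗g zero) (∑-cong n (f≗g ∘ suc))

∑-split : ∀ n {h f g : Fin n → ℕ} → (∀ i → h i ≡ f i + g i) → ∑ n h ≡ ∑ n f + ∑ n g
∑-split n {h} {f} {g} h≗f+g = begin
  ∑ n h                  ≡⟨ ∑-cong n h≗f+g ⟩
  ∑ n (λ i → f i + g i)  ≡⟨ ∑≡sum n _ ⟩
  sum (λ i → f i + g i)  ≡⟨ ∑-distrib-+ f g ⟩
  sum f + sum g          ≡⟨ sym (cong₂ _+_ (∑≡sum n f) (∑≡sum n g)) ⟩
  ∑ n f + ∑ n g          ∎

[]-∨-disjoint : ∀ x y → (T x → T y → ⊥) → [ x ∨ y ] ≡ [ x ] + [ y ]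
[]-∨-disjoint true  true  x⊥y = ⊥-elim (x⊥y _ _)
[]-∨-disjoint true  false _   = refl
[]-∨-disjoint false _     _   = refl

[]-∨-∧-disjoint : ∀ x y z → (T x → T y → ⊥) → [ (x ∨ y) ∧ z ] ≡ [ x ∧ z ] + [ y ∧ z ]
[]-∨-∧-disjoint x y z x⊥y = trans (cong [_] (∧-distribʳ-∨ z x y))
  ([]-∨-disjoint (x ∧ z) (y ∧ z) λ xz yz → x⊥y (proj₁ (to T-∧ xz)) (proj₁ (to T-∧ yz)))

[]-∧-split : ∀ k {z z₁ z₂} → (T k → [ z ] ≡ [ z₁ ] + [ z₂ ]) → [ k ∧ z ] ≡ [ k ∧ z₁ ] + [ k ∧ z₂ ]
[]-∧-split true  h = h _
[]-∧-split false h = refl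

[]-*-congˡ-under : ∀ x {m m′} → (T x → m ≡ m′) → [ x ] * m ≡ [ x ] * m′
[]-*-congˡ-under true  h = cong (1 *_) (h _)
[]-*-congˡ-under false h = refl

∧-congˡ-under : ∀ k {x y} → (T k → x ≡ y) → k ∧ x ≡ k ∧ y
∧-congˡ-under true  h = h _
∧-congˡ-under false h = refl

∧-∧-congʳ-under : ∀ z {x x′ y y′} → (T z → x ≡ x′ × y ≡ y′) → x ∧ y ∧ z ≡ x′ ∧ y′ ∧ z
∧-∧-congʳ-under true  h with h _
... | refl , refl = refl
∧-∧-congʳ-under false {x} {x′} {y} {y′} h = trans (∧-∧-false x y) (sym (∧-∧-false x′ y′))
  where
  ∧-∧-false : ∀ x y → x ∧ y ∧ false ≡ false
  ∧-∧-false x y = trans (cong (x ∧_) (∧-zeroʳ y)) (∧-zeroʳ x)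

∈ᵇ≡lookup : ∀ {n} (u : Fin n) (X : Subset n) → u ∈ᵇ X ≡ lookup X u
∈ᵇ≡lookup zero    (true  ∷ X) = refl
∈ᵇ≡lookup zero    (false ∷ X) = refl
∈ᵇ≡lookup (suc u) (_     ∷ X) = ∈ᵇ≡lookup u X

∈ᵇ-∪ : ∀ {n} (u : Fin n) (X Y : Subset n) → u ∈ᵇ (X ∪ Y) ≡ u ∈ᵇ X ∨ u ∈ᵇ Y
∈ᵇ-∪ u X Y = begin
  u ∈ᵇ (X ∪ Y)             ≡⟨ ∈ᵇ≡lookup u (X ∪ Y) ⟩
  lookup (X ∪ Y) u         ≡⟨ lookup-zipWith _∨_ u X Y ⟩
  lookup X u ∨ lookup Y u  ≡⟨ sym (cong₂ _∨_ (∈ᵇ≡lookup u X) (∈ᵇ≡lookup u Y)) ⟩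
  u ∈ᵇ X ∨ u ∈ᵇ Y          ∎

bag⊆Vb : ∀ {n} (t : Tree n) → bag t ⊆ Vb t
bag⊆Vb (leaf D)         u∈D = u∈D
bag⊆Vb (unary D t)      u∈D = x∈p∪q⁺ (inj₁ u∈D)
bag⊆Vb (binary D t₁ t₂) u∈D = x∈p∪q⁺ (inj₁ u∈D)

-- forgotten G b π* u does not use G or π*; this is the same boolean without them.
forgottenᵇ : ∀ {n} → Tree n → Fin n → Bool
forgottenᵇ b u = u ∈ᵇ Vb b ∧ not (u ∈ᵇ bag b)

Forgotten : ∀ {n} → Tree n → Fin n → Set
Forgotten b u = u ∈ Vb b × u ∉ bag b

T-∈ᵇ : ∀ {n} {u : Fin n} X → T (u ∈ᵇ X) → u ∈ X
T-∈ᵇ {u = u} X t with u ∈? X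
... | yes u∈X = u∈X

T-not-∈ᵇ : ∀ {n} {u : Fin n} X → T (not (u ∈ᵇ X)) → u ∉ X
T-not-∈ᵇ {u = u} X t with u ∈? X
... | no u∉X = u∉X

T-forgottenᵇ : ∀ {n} (b : Tree n) u → T (forgottenᵇ b u) → Forgotten b u
T-forgottenᵇ b u f with to (T-∧ {u ∈ᵇ Vb b}) f
... | inVb , notInBag = T-∈ᵇ (Vb b) inVb , T-not-∈ᵇ (bag b) notInBag

forgottenᵇ-binary : ∀ {n} (t₁ t₂ : Tree n) → bag t₁ ≡ bag t₂ → ∀ u →
  forgottenᵇ (binary (bag t₁) t₁ t₂) u ≡ forgottenᵇ t₁ u ∨ forgottenᵇ t₂ u
forgottenᵇ-binary t₁ t₂ bag₁≡bag₂ u = begin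
  u ∈ᵇ (bag t₁ ∪ (Vb t₁ ∪ Vb t₂)) ∧ not d  ≡⟨ cong (_∧ not d) (∈ᵇ-∪ u (bag t₁) _) ⟩
  (d ∨ u ∈ᵇ (Vb t₁ ∪ Vb t₂)) ∧ not d       ≡⟨ cong (λ x → (d ∨ x) ∧ not d) (∈ᵇ-∪ u (Vb t₁) (Vb t₂)) ⟩
  (d ∨ (v₁ ∨ v₂)) ∧ not d                  ≡⟨ ∨-∧-not d (v₁ ∨ v₂) ⟩
  (v₁ ∨ v₂) ∧ not d                        ≡⟨ ∧-distribʳ-∨ (not d) v₁ v₂ ⟩
  v₁ ∧ not d ∨ v₂ ∧ not d                  ≡⟨ cong (λ X → v₁ ∧ not d ∨ v₂ ∧ not (u ∈ᵇ X)) bag₁≡bag₂ ⟩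
  forgottenᵇ t₁ u ∨ forgottenᵇ t₂ u        ∎
  where
  d v₁ v₂ : Bool
  d  = u ∈ᵇ bag t₁
  v₁ = u ∈ᵇ Vb t₁
  v₂ = u ∈ᵇ Vb t₂
  ∨-∧-not : ∀ d x → (d ∨ x) ∧ not d ≡ x ∧ not d
  ∨-∧-not true  x = sym (∧-zeroʳ x)
  ∨-∧-not false x = refl

-- sameConsec also carries b and π* as unused parameters, but as it is defined by
-- recursion they do not compute away.
sameConsec-cong : ∀ {n τ} (G : TemporalGraph n τ) {c} (b b′ : Tree n) (π π′ : Fin n → Fin τ → Fin c)
  {k} {f g : Fin k → Fin c} → (∀ i → f i ≡ g i) → sameConsec G b π f ≡ sameConsec G b′ π′ g
sameConsec-cong G b b′ π π′ {zero}  f≗g = refl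
sameConsec-cong G b b′ π π′ {suc k} f≗g =
  ∑-cong k λ i → cong [_] (cong₂ _==_ (f≗g (inject₁ i)) (f≗g (suc i)))

Separated : ∀ {n} → Tree n → Tree n → Set
Separated t₁ t₂ = ∀ {u} → u ∈ Vb t₁ → u ∈ Vb t₂ → u ∈ bag t₁

module _ {n τ : ℕ} (G : TemporalGraph n τ) where
  open TemporalGraph G

  NeighbourClosed : Tree n → Set
  NeighbourClosed t = ∀ {u v} → adj u v ≡ true → Forgotten t u → v ∈ Vb t

  edge-endpoints-in-Vb : ∀ b {u v t} → NeighbourClosed b →
    T (edgeAt G u v t) → T (forgottenᵇ b u ∨ forgottenᵇ b v) → u ∈ Vb b × v ∈ Vb b
  edge-endpoints-in-Vb b {u} {v} {t} closed e f = endpoints (to (T-∨ {forgottenᵇ b u}) f)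
    where
    uv : adj u v ≡ true
    uv = lab-edge u v t (to T-≡ e)
    endpoints : T (forgottenᵇ b u) ⊎ T (forgottenᵇ b v) → u ∈ Vb b × v ∈ Vb b
    endpoints (inj₁ fu) = proj₁ (T-forgottenᵇ b u fu) , closed uv (T-forgottenᵇ b u fu)
    endpoints (inj₂ fv) = closed (trans (adj-sym v u) uv) (T-forgottenᵇ b v fv) , proj₁ (T-forgottenᵇ b v fv)

infix 4 _≼_

data _≼_ {n : ℕ} : {t : Tree n} → Pos t → Pos t → Set where
  here≼ : ∀ {t} {p : Pos t} → here ≼ p
  inU≼  : ∀ {D t} {c p : Pos t} → c ≼ p → _≼_ {t = unary D t} (inU c) (inU p)
  inL≼  : ∀ {D t₁ t₂} {c p : Pos t₁} → c ≼ p → _≼_ {t = binary D t₁ t₂} (inL c) (inL p)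
  inR≼  : ∀ {D t₁ t₂} {c p : Pos t₂} → c ≼ p → _≼_ {t = binary D t₁ t₂} (inR c) (inR p)

≼-child : ∀ {n} {t : Tree n} {c x y : Pos t} → ChildOf x y → c ≼ x → c ≼ y
≼-child _       here≼     = here≼
≼-child (dU ch) (inU≼ c≼x) = inU≼ (≼-child ch c≼x)
≼-child (dL ch) (inL≼ c≼x) = inL≼ (≼-child ch c≼x)
≼-child (dR ch) (inR≼ c≼x) = inR≼ (≼-child ch c≼x)

≼-parent : ∀ {n} {t : Tree n} {c x y : Pos t} → ChildOf y x → c ≼ x → c ≼ y ⊎ x ≡ c
≼-parent _       here≼           = inj₁ here≼
≼-parent cU      (inU≼ here≼)    = inj₂ refl
≼-parent cL      (inL≼ here≼)    = inj₂ refl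
≼-parent cR      (inR≼ here≼)    = inj₂ refl
≼-parent (dU ch) (inU≼ c≼x) = Sum.map inU≼ (cong inU) (≼-parent ch c≼x)
≼-parent (dL ch) (inL≼ c≼x) = Sum.map inL≼ (cong inL) (≼-parent ch c≼x)
≼-parent (dR ch) (inR≼ c≼x) = Sum.map inR≼ (cong inR) (≼-parent ch c≼x)

≼-lift : ∀ {n} {t : Tree n} (c : Pos t) (q : Pos (sub t c)) →
  Σ (Pos t) λ p → c ≼ p × sub t p ≡ sub (sub t c) q
≼-lift here    q = q , here≼ , refl
≼-lift (inU c) q = let p , c≼p , eq = ≼-lift c q in inU p , inU≼ c≼p , eq
≼-lift (inL c) q = let p , c≼p , eq = ≼-lift c q in inL p , inL≼ c≼p , eq
≼-lift (inR c) q = let p , c≼p , eq = ≼-lift c q in inR p , inR≼ c≼p , eq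

≼-lower : ∀ {n} {t : Tree n} {c p : Pos t} → c ≼ p → Σ (Pos (sub t c)) λ q → sub t p ≡ sub (sub t c) q
≼-lower {p = p} here≼ = p , refl
≼-lower (inU≼ c≼p)    = ≼-lower c≼p
≼-lower (inL≼ c≼p)    = ≼-lower c≼p
≼-lower (inR≼ c≼p)    = ≼-lower c≼p

∈Vb⇒∈bag : ∀ {n} {u : Fin n} (t : Tree n) → u ∈ Vb t → ∃ λ (q : Pos t) → u ∈ bag (sub t q)
∈Vb⇒∈bag (leaf D) u∈V = here , u∈V
∈Vb⇒∈bag (unary D t) u∈V with x∈p∪q⁻ D (Vb t) u∈V
... | inj₁ u∈D = here , u∈D
... | inj₂ u∈V′ = map inU id (∈Vb⇒∈bag t u∈V′)
∈Vb⇒∈bag (binary D t₁ t₂) u∈V with x∈p∪q⁻ D (Vb t₁ ∪ Vb t₂) u∈V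
... | inj₁ u∈D = here , u∈D
... | inj₂ u∈V′ with x∈p∪q⁻ (Vb t₁) (Vb t₂) u∈V′
...   | inj₁ u∈V₁ = map inL id (∈Vb⇒∈bag t₁ u∈V₁)
...   | inj₂ u∈V₂ = map inR id (∈Vb⇒∈bag t₂ u∈V₂)

∈bag⇒∈Vb : ∀ {n} {u : Fin n} (t : Tree n) (q : Pos t) → u ∈ bag (sub t q) → u ∈ Vb t
∈bag⇒∈Vb t                here    u∈q = bag⊆Vb t u∈q
∈bag⇒∈Vb (unary D t)      (inU q) u∈q = x∈p∪q⁺ (inj₂ (∈bag⇒∈Vb t q u∈q))
∈bag⇒∈Vb (binary D t₁ t₂) (inL q) u∈q = x∈p∪q⁺ {p = D} (inj₂ (x∈p∪q⁺ (inj₁ (∈bag⇒∈Vb t₁ q u∈q))))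
∈bag⇒∈Vb (binary D t₁ t₂) (inR q) u∈q = x∈p∪q⁺ {p = D} (inj₂ (x∈p∪q⁺ {p = Vb t₁} (inj₂ (∈bag⇒∈Vb t₂ q u∈q))))

∈Vb-sub⇒∈bag-below : ∀ {n} {u : Fin n} {H : Tree n} (c : Pos H) → u ∈ Vb (sub H c) →
  ∃ λ p → c ≼ p × u ∈ bag (sub H p)
∈Vb-sub⇒∈bag-below {u = u} c u∈V with ∈Vb⇒∈bag _ u∈V
... | q , u∈q with ≼-lift c q
...   | p , c≼p , eq = p , c≼p , subst (λ t → u ∈ bag t) (sym eq) u∈q

∈bag-below⇒∈Vb-sub : ∀ {n} {u : Fin n} {H : Tree n} {c p : Pos H} → c ≼ p → u ∈ bag (sub H p) → u ∈ Vb (sub H c)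
∈bag-below⇒∈Vb-sub {u = u} c≼p u∈p with ≼-lower c≼p
... | q , eq = ∈bag⇒∈Vb _ q (subst (λ t → u ∈ bag t) eq u∈p)

binary-children : ∀ {n} {H : Tree n} (b : Pos H) {D t₁ t₂} → sub H b ≡ binary D t₁ t₂ →
  Σ (Pos H) λ cl → Σ (Pos H) λ cr → sub H cl ≡ t₁ × sub H cr ≡ t₂ × (∀ {p} → cl ≼ p → cr ≼ p → ⊥)
binary-children here refl = inL here , inR here , refl , refl , λ { (inL≼ _) () }
binary-children (inU b) eq =
  let cl , cr , eq₁ , eq₂ , apart = binary-children b eq
  in inU cl , inU cr , eq₁ , eq₂ , λ { (inU≼ x) (inU≼ y) → apart x y }
binary-children (inL b) eq =
  let cl , cr , eq₁ , eq₂ , apart = binary-children b eq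
  in inL cl , inL cr , eq₁ , eq₂ , λ { (inL≼ x) (inL≼ y) → apart x y }
binary-children (inR b) eq =
  let cl , cr , eq₁ , eq₂ , apart = binary-children b eq
  in inR cl , inR cr , eq₁ , eq₂ , λ { (inR≼ x) (inR≼ y) → apart x y }

module _ {n τ : ℕ} {G : TemporalGraph n τ} {H : Tree n} (td : IsTreeDecomposition G H) where
  open IsTreeDecomposition td

  -- A path of bags containing u can only leave the subtree at c through c itself.
  path-stays-below : ∀ {u} {c : Pos H} → u ∉ bag (sub H c) → ∀ {x y} → c ≼ x →
    Star (λ x y → TreeAdj x y × u ∈ bag (sub H x) × u ∈ bag (sub H y)) x y → c ≼ y
  path-stays-below u∉c c≼x ε = c≼x
  path-stays-below u∉c c≼x ((inj₁ x→y , _) ◅ path) = path-stays-below u∉c (≼-child x→y c≼x) path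
  path-stays-below u∉c c≼x ((inj₂ y→x , u∈x , _) ◅ path) with ≼-parent y→x c≼x
  ... | inj₁ c≼y = path-stays-below u∉c c≼y path
  ... | inj₂ refl = contradiction u∈x u∉c

  forgotten-confined : ∀ {u} (c : Pos H) → Forgotten (sub H c) u → ∀ p → u ∈ bag (sub H p) → c ≼ p
  forgotten-confined {u} c (u∈V , u∉c) p u∈p =
    let q , c≼q , u∈q = ∈Vb-sub⇒∈bag-below c u∈V
    in path-stays-below u∉c c≼q (connected u q p u∈q u∈p)

  neighbourClosed : (c : Pos H) → NeighbourClosed G (sub H c)
  neighbourClosed c {u} {v} uv u-forgotten with edge-cover u v uv
  ... | p , u∈p , v∈p = ∈bag-below⇒∈Vb-sub (forgotten-confined c u-forgotten p u∈p) v∈p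

  siblings-separated : ∀ {cl cr : Pos H} → (∀ {p} → cl ≼ p → cr ≼ p → ⊥) → Separated (sub H cl) (sub H cr)
  siblings-separated {cl} {cr} apart {u} u∈V₁ u∈V₂ with u ∈? bag (sub H cl)
  ... | yes u∈bag = u∈bag
  ... | no  u∉bag =
    let p , cr≼p , u∈p = ∈Vb-sub⇒∈bag-below cr u∈V₂
    in ⊥-elim (apart (forgotten-confined cl (u∈V₁ , u∉bag) p u∈p) cr≼p)

module _ {n τ : ℕ} (G : TemporalGraph n τ) {c : ℕ} (b : Tree n) {π π′ : Fin n → Fin τ → Fin c}
  (π≗π′ : ∀ {u} t → u ∈ Vb b → π u t ≡ π′ u t) where

  alphaOf-local : NeighbourClosed G b → ∀ p → alphaOf G b π p ≡ alphaOf G b π′ p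
  alphaOf-local closed p = ∑-cong τ λ t → ∑-cong n λ u → ∑-cong n λ v →
    cong (λ x → [ (toℕ u <ᵇ toℕ v) ∧ x ]) (∧-congˡ-under (edgeAt G u v t) λ e →
      ∧-∧-congʳ-under (forgottenᵇ b u ∨ forgottenᵇ b v) λ f →
        let u∈V , v∈V = edge-endpoints-in-Vb G b closed e f
        in cong (_== p) (π≗π′ t u∈V) , cong (_== p) (π≗π′ t v∈V))

  betaOf-local : ∀ p t → betaOf G b π p t ≡ betaOf G b π′ p t
  betaOf-local p t = ∑-cong n λ u → cong (λ x → [ x ] * deg G u t)
    (∧-congˡ-under (forgottenᵇ b u) λ f → cong (_== p) (π≗π′ t (proj₁ (T-forgottenᵇ b u f))))

  gammaOf-local : gammaOf G b π ≡ gammaOf G b π′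
  gammaOf-local = ∑-cong n λ u → []-*-congˡ-under (forgottenᵇ b u) λ f →
    sameConsec-cong G b b π π′ λ t → π≗π′ t (proj₁ (T-forgottenᵇ b u f))

stateOf : ∀ {n τ} (G : TemporalGraph n τ) {c} → Tree n → (Fin n → Fin τ → Fin c) →
  (Fin n → Fin τ → Fin c) → State n τ c
stateOf G b π* π = state π (alphaOf G b π*) (betaOf G b π*) (ℤ.+ gammaOf G b π*)

stateOf-supported : ∀ {n τ} (G : TemporalGraph n τ) {c} (b : Tree n) {π* π : Fin n → Fin τ → Fin c} →
  (∀ v t → v ∈ bag b → π* v t ≡ π v t) → Supports G b π* (stateOf G b π* π)
stateOf-supported G b π*≗π = π*≗π , (λ _ → refl) , (λ _ _ → refl) , refl

summands-≤ : ∀ {a b c k} → a ≡ b + c → a ≤ k → b ≤ k × c ≤ k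
summands-≤ {b = b} {c} refl a≤k = ≤-trans (m≤m+n b c) a≤k , ≤-trans (m≤n+m c b) a≤k

InRange-summands : ∀ {n τ} (G : TemporalGraph n τ) {c} {s s₁ s₂ : State n τ c} →
  (∀ p → State.α s p ≡ State.α s₁ p + State.α s₂ p) →
  (∀ p t → State.β s p t ≡ State.β s₁ p t + State.β s₂ p t) →
  InRange G s → InRange G s₁ × InRange G s₂
InRange-summands G α≡ β≡ (α≤ , β≤) =
  ((λ p → proj₁ (summands-≤ (α≡ p) (α≤ p))) , (λ p t → proj₁ (summands-≤ (β≡ p t) (β≤ p t)))) ,
  ((λ p → proj₂ (summands-≤ (α≡ p) (α≤ p))) , (λ p t → proj₂ (summands-≤ (β≡ p t) (β≤ p t))))

module Join {n τ : ℕ} (G : TemporalGraph n τ) {c : ℕ} (t₁ t₂ : Tree n)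
  (bag₁≡bag₂ : bag t₁ ≡ bag t₂) (separated : Separated t₁ t₂)
  (closed₁ : NeighbourClosed G t₁) (closed₂ : NeighbourClosed G t₂) where
  open TemporalGraph G
  open State

  D : Subset n
  D = bag t₁

  join : Tree n
  join = binary D t₁ t₂

  forgottenᵇ-join : ∀ u → forgottenᵇ join u ≡ forgottenᵇ t₁ u ∨ forgottenᵇ t₂ u
  forgottenᵇ-join = forgottenᵇ-binary t₁ t₂ bag₁≡bag₂

  forgotten-disjoint : ∀ {u} → Forgotten t₁ u → Forgotten t₂ u → ⊥
  forgotten-disjoint (u∈V₁ , _) (u∈V₂ , u∉D₂) = u∉D₂ (subst (_ ∈_) bag₁≡bag₂ (separated u∈V₁ u∈V₂))

  forgotten-edge-disjoint : ∀ {u v} → adj u v ≡ true → Forgotten t₁ u → Forgotten t₂ v → ⊥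
  forgotten-edge-disjoint uv u-forgotten (v∈V₂ , v∉D₂) =
    v∉D₂ (subst (_ ∈_) bag₁≡bag₂ (separated (closed₁ uv u-forgotten) v∈V₂))

  forgottenᵇ-disjoint : ∀ u → T (forgottenᵇ t₁ u) → T (forgottenᵇ t₂ u) → ⊥
  forgottenᵇ-disjoint u f₁ f₂ = forgotten-disjoint (T-forgottenᵇ t₁ u f₁) (T-forgottenᵇ t₂ u f₂)

  edge-forgottenᵇ-disjoint : ∀ {u v} → adj u v ≡ true →
    T (forgottenᵇ t₁ u ∨ forgottenᵇ t₁ v) → T (forgottenᵇ t₂ u ∨ forgottenᵇ t₂ v) → ⊥
  edge-forgottenᵇ-disjoint {u} {v} uv f₁ f₂
    with to (T-∨ {forgottenᵇ t₁ u}) f₁ | to (T-∨ {forgottenᵇ t₂ u}) f₂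
  ... | inj₁ f₁u | inj₁ f₂u = forgottenᵇ-disjoint u f₁u f₂u
  ... | inj₁ f₁u | inj₂ f₂v = forgotten-edge-disjoint uv (T-forgottenᵇ t₁ u f₁u) (T-forgottenᵇ t₂ v f₂v)
  ... | inj₂ f₁v | inj₁ f₂u =
    forgotten-edge-disjoint (trans (adj-sym v u) uv) (T-forgottenᵇ t₁ v f₁v) (T-forgottenᵇ t₂ u f₂u)
  ... | inj₂ f₁v | inj₂ f₂v = forgottenᵇ-disjoint v f₁v f₂v

  alphaOf-join : ∀ (π : Fin n → Fin τ → Fin c) p → alphaOf G join π p ≡ alphaOf G t₁ π p + alphaOf G t₂ π p
  alphaOf-join π p = ∑-split τ λ t → ∑-split n λ u → ∑-split n λ v →
    []-∧-split (toℕ u <ᵇ toℕ v) λ _ → []-∧-split (edgeAt G u v t) λ e →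
    []-∧-split (π u t == p) λ _ → []-∧-split (π v t == p) λ _ → endpoints-split (lab-edge u v t (to T-≡ e))
    where
    endpoints-split : ∀ {u v} → adj u v ≡ true →
      [ forgottenᵇ join u ∨ forgottenᵇ join v ] ≡
      [ forgottenᵇ t₁ u ∨ forgottenᵇ t₁ v ] + [ forgottenᵇ t₂ u ∨ forgottenᵇ t₂ v ]
    endpoints-split {u} {v} uv = begin
      [ forgottenᵇ join u ∨ forgottenᵇ join v ]
        ≡⟨ cong₂ (λ x y → [ x ∨ y ]) (forgottenᵇ-join u) (forgottenᵇ-join v) ⟩
      [ (forgottenᵇ t₁ u ∨ forgottenᵇ t₂ u) ∨ (forgottenᵇ t₁ v ∨ forgottenᵇ t₂ v) ]
        ≡⟨ cong [_] (∨-interchange (forgottenᵇ t₁ u) _ _ _) ⟩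
      [ (forgottenᵇ t₁ u ∨ forgottenᵇ t₁ v) ∨ (forgottenᵇ t₂ u ∨ forgottenᵇ t₂ v) ]
        ≡⟨ []-∨-disjoint _ _ (edge-forgottenᵇ-disjoint uv) ⟩
      [ forgottenᵇ t₁ u ∨ forgottenᵇ t₁ v ] + [ forgottenᵇ t₂ u ∨ forgottenᵇ t₂ v ] ∎

  betaOf-join : ∀ (π : Fin n → Fin τ → Fin c) p t → betaOf G join π p t ≡ betaOf G t₁ π p t + betaOf G t₂ π p t
  betaOf-join π p t = ∑-split n λ u → begin
    [ forgottenᵇ join u ∧ q u ] * deg G u t
      ≡⟨ cong (λ x → [ x ∧ q u ] * deg G u t) (forgottenᵇ-join u) ⟩
    [ (forgottenᵇ t₁ u ∨ forgottenᵇ t₂ u) ∧ q u ] * deg G u t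
      ≡⟨ cong (_* deg G u t) ([]-∨-∧-disjoint _ _ (q u) (forgottenᵇ-disjoint u)) ⟩
    ([ forgottenᵇ t₁ u ∧ q u ] + [ forgottenᵇ t₂ u ∧ q u ]) * deg G u t
      ≡⟨ *-distribʳ-+ (deg G u t) [ forgottenᵇ t₁ u ∧ q u ] _ ⟩
    [ forgottenᵇ t₁ u ∧ q u ] * deg G u t + [ forgottenᵇ t₂ u ∧ q u ] * deg G u t ∎
    where
    q : Fin n → Bool
    q u = π u t == p

  gammaOf-join : ∀ (π : Fin n → Fin τ → Fin c) → gammaOf G join π ≡ gammaOf G t₁ π + gammaOf G t₂ π
  gammaOf-join π = ∑-split n λ u → begin
    [ forgottenᵇ join u ] * sameConsec G join π (π u)
      ≡⟨ cong (λ x → [ x ] * sameConsec G join π (π u)) (forgottenᵇ-join u) ⟩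
    [ forgottenᵇ t₁ u ∨ forgottenᵇ t₂ u ] * sameConsec G join π (π u)
      ≡⟨ cong (_* sameConsec G join π (π u)) ([]-∨-disjoint _ _ (forgottenᵇ-disjoint u)) ⟩
    ([ forgottenᵇ t₁ u ] + [ forgottenᵇ t₂ u ]) * sameConsec G join π (π u)
      ≡⟨ *-distribʳ-+ (sameConsec G join π (π u)) [ forgottenᵇ t₁ u ] _ ⟩
    [ forgottenᵇ t₁ u ] * sameConsec G join π (π u) + [ forgottenᵇ t₂ u ] * sameConsec G join π (π u)
      ≡⟨ cong₂ _+_ (cong ([ forgottenᵇ t₁ u ] *_) (sameConsec-cong G join t₁ π π {f = π u} λ _ → refl))
                   (cong ([ forgottenᵇ t₂ u ] *_) (sameConsec-cong G join t₂ π π {f = π u} λ _ → refl)) ⟩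
    [ forgottenᵇ t₁ u ] * sameConsec G t₁ π (π u) + [ forgottenᵇ t₂ u ] * sameConsec G t₂ π (π u) ∎

  Decomposes : State n τ c → Set
  Decomposes s = Σ (State n τ c) λ s₁ → Σ (State n τ c) λ s₂ →
    InRange G s₁ × InRange G s₂ ×
    Valid G t₁ s₁ × Valid G t₂ s₂ ×
    (∀ v t → v ∈ D → (π s v t ≡ π s₁ v t) × (π s₁ v t ≡ π s₂ v t)) ×
    (∀ p → α s p ≡ α s₁ p + α s₂ p) ×
    (∀ p t → β s p t ≡ β s₁ p t + β s₂ p t) ×
    (γ s ≡ γ s₁ +ℤ γ s₂)

  split : ∀ s → InRange G s → Valid G join s → Decomposes s
  split s inRange (π* , π*≗π , α≡ , β≡ , γ≡) =
    s₁ , s₂ , proj₁ inRanges , proj₂ inRanges ,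
    (π* , stateOf-supported G t₁ π*≗π) ,
    (π* , stateOf-supported G t₂ λ v t v∈ → π*≗π v t (subst (v ∈_) (sym bag₁≡bag₂) v∈)) ,
    (λ _ _ _ → refl , refl) , α-split , β-split , γ-split
    where
    s₁ s₂ : State n τ c
    s₁ = stateOf G t₁ π* (π s)
    s₂ = stateOf G t₂ π* (π s)
    α-split : ∀ p → α s p ≡ α s₁ p + α s₂ p
    α-split p = trans (α≡ p) (alphaOf-join π* p)
    β-split : ∀ p t → β s p t ≡ β s₁ p t + β s₂ p t
    β-split p t = trans (β≡ p t) (betaOf-join π* p t)
    γ-split : γ s ≡ γ s₁ +ℤ γ s₂
    γ-split = trans γ≡ (cong ℤ.+_ (gammaOf-join π*))
    inRanges : InRange G s₁ × InRange G s₂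
    inRanges = InRange-summands G {s = s} {s₁} {s₂} α-split β-split inRange

  glue : (π₁ π₂ : Fin n → Fin τ → Fin c) → Fin n → Fin τ → Fin c
  glue π₁ π₂ u with u ∈? Vb t₂
  ... | yes _ = π₂ u
  ... | no  _ = π₁ u

  glue-on₂ : ∀ π₁ π₂ {u} t → u ∈ Vb t₂ → glue π₁ π₂ u t ≡ π₂ u t
  glue-on₂ π₁ π₂ {u} t u∈V₂ with u ∈? Vb t₂
  ... | yes _     = refl
  ... | no  u∉V₂ = contradiction u∈V₂ u∉V₂

  glue-on₁ : ∀ π₁ π₂ → (∀ {u} t → u ∈ D → π₁ u t ≡ π₂ u t) → ∀ {u} t → u ∈ Vb t₁ → glue π₁ π₂ u t ≡ π₁ u t
  glue-on₁ π₁ π₂ π₁≗π₂ {u} t u∈V₁ with u ∈? Vb t₂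
  ... | yes u∈V₂ = sym (π₁≗π₂ t (separated u∈V₁ u∈V₂))
  ... | no  _    = refl

  merge : ∀ s → Decomposes s → Valid G join s
  merge s (s₁ , s₂ , _ , _ , (π₁ , π₁≗ , α₁≡ , β₁≡ , γ₁≡) , (π₂ , π₂≗ , α₂≡ , β₂≡ , γ₂≡) , π≡ , α≡ , β≡ , γ≡) =
    π* , π*≗π , α-merge , β-merge , γ-merge
    where
    π₁≗π : ∀ {v} t → v ∈ D → π₁ v t ≡ π s v t
    π₁≗π {v} t v∈ = trans (π₁≗ v t v∈) (sym (proj₁ (π≡ v t v∈)))
    π₂≗π : ∀ {v} t → v ∈ D → π₂ v t ≡ π s v t
    π₂≗π {v} t v∈ = trans (π₂≗ v t (subst (v ∈_) bag₁≡bag₂ v∈)) (sym (uncurry trans (π≡ v t v∈)))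
    π* : Fin n → Fin τ → Fin c
    π* = glue π₁ π₂
    on₁ : ∀ {u} t → u ∈ Vb t₁ → π₁ u t ≡ π* u t
    on₁ t u∈V₁ = sym (glue-on₁ π₁ π₂ (λ t v∈ → trans (π₁≗π t v∈) (sym (π₂≗π t v∈))) t u∈V₁)
    on₂ : ∀ {u} t → u ∈ Vb t₂ → π₂ u t ≡ π* u t
    on₂ t u∈V₂ = sym (glue-on₂ π₁ π₂ t u∈V₂)
    π*≗π : ∀ v t → v ∈ D → π* v t ≡ π s v t
    π*≗π v t v∈ = trans (sym (on₁ t (bag⊆Vb t₁ v∈))) (π₁≗π t v∈)
    α-merge : ∀ p → α s p ≡ alphaOf G join π* p
    α-merge p = begin
      α s p                                        ≡⟨ α≡ p ⟩
      α s₁ p + α s₂ p                              ≡⟨ cong₂ _+_ (α₁≡ p) (α₂≡ p) ⟩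
      alphaOf G t₁ π₁ p + alphaOf G t₂ π₂ p        ≡⟨ cong₂ _+_ (alphaOf-local G t₁ on₁ closed₁ p) (alphaOf-local G t₂ on₂ closed₂ p) ⟩
      alphaOf G t₁ π* p + alphaOf G t₂ π* p        ≡⟨ sym (alphaOf-join π* p) ⟩
      alphaOf G join π* p                          ∎
    β-merge : ∀ p t → β s p t ≡ betaOf G join π* p t
    β-merge p t = begin
      β s p t                                      ≡⟨ β≡ p t ⟩
      β s₁ p t + β s₂ p t                          ≡⟨ cong₂ _+_ (β₁≡ p t) (β₂≡ p t) ⟩
      betaOf G t₁ π₁ p t + betaOf G t₂ π₂ p t      ≡⟨ cong₂ _+_ (betaOf-local G t₁ on₁ p t) (betaOf-local G t₂ on₂ p t) ⟩
      betaOf G t₁ π* p t + betaOf G t₂ π* p t      ≡⟨ sym (betaOf-join π* p t) ⟩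
      betaOf G join π* p t                         ∎
    γ-merge : γ s ≡ ℤ.+ gammaOf G join π*
    γ-merge = begin
      γ s                                          ≡⟨ γ≡ ⟩
      γ s₁ +ℤ γ s₂                                 ≡⟨ cong₂ _+ℤ_ γ₁≡ γ₂≡ ⟩
      ℤ.+ (gammaOf G t₁ π₁ + gammaOf G t₂ π₂)      ≡⟨ cong ℤ.+_ (cong₂ _+_ (gammaOf-local G t₁ on₁) (gammaOf-local G t₂ on₂)) ⟩
      ℤ.+ (gammaOf G t₁ π* + gammaOf G t₂ π*)      ≡⟨ cong ℤ.+_ (sym (gammaOf-join π*)) ⟩
      ℤ.+ gammaOf G join π*                        ∎

  valid⇔decomposes : ∀ s → InRange G s → Valid G join s ⇔ Decomposes s
  valid⇔decomposes s inRange = mk⇔ (split s inRange) (merge s)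

lemma10 : ∀ {n T : ℕ} (G : TemporalGraph n T) (c : ℕ) → 1 ≤ c →
    (H : Tree n) → IsNiceTreeDecomposition G H →
    (b : Pos H) (D : Subset n) (t₁ t₂ : Tree n) →
    sub H b ≡ binary D t₁ t₂ → D ≡ bag t₁ → D ≡ bag t₂ →
    (s : State n T c) → InRange G s →
    Valid G (sub H b) s ⇔
      (Σ (State n T c) λ s₁ → Σ (State n T c) λ s₂ →
        InRange G s₁ × InRange G s₂ ×
        Valid G t₁ s₁ × Valid G t₂ s₂ ×
        (∀ v t → v ∈ D → (State.π s v t ≡ State.π s₁ v t) × (State.π s₁ v t ≡ State.π s₂ v t)) ×
        (∀ p → State.α s p ≡ State.α s₁ p + State.α s₂ p) ×
        (∀ p t → State.β s p t ≡ State.β s₁ p t + State.β s₂ p t) ×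
        (State.γ s ≡ State.γ s₁ +ℤ State.γ s₂))
lemma10 G c _ H nice b D t₁ t₂ b≡join refl bag₁≡bag₂ s inRange with binary-children b b≡join
... | cl , cr , refl , refl , apart rewrite b≡join =
  Join.valid⇔decomposes G (sub H cl) (sub H cr) bag₁≡bag₂
    (siblings-separated td apart) (neighbourClosed td cl) (neighbourClosed td cr) s inRange
  where
  td : IsTreeDecomposition G H
  td = IsNiceTreeDecomposition.isTD nice
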